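{- For positive integers $n$ and $i$, the number of accurate dominating sets of the path $P_n$ of cardinality $i$ satisfies $$d_a(P_n,i)\geq 2\,d(P_{n-3},i-2)-d(P_{n-6},i-4).$$
   Context: $P_m$ denotes the path on $m$ vertices. A dominating set of a graph $G=(V,E)$ is a set $D\subseteq V$ such that every vertex not in $D$ is adjacent to some vertex of $D$. A dominating set $D$ is accurate if no $|D|$-element subset of $V\setminus D$ is a dominating set of $G$. $d(G,j)$ is the number of dominating sets of $G$ of cardinality $j$ and $d_a(G,j)$ the number of accurate dominating sets of $G$ of cardinality $j$. -}

module Defs where

open import Data.Nat using (ℕ; zero; suc; _+_)
open import Data.Integer using (ℤ; +_; -[1+_])
open import Data.Bool using (if_then_else_)
open import Data.Fin using (Fin; toℕ)
open import Data.Fin.Subset using (Subset; inside; outside; _∈_; ∁; ∣_∣)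
open import Data.Fin.Subset.Properties using (_∈?_; anySubset?)
open import Data.Fin.Properties using (all?; any?)
open import Data.Vec using ([]; _∷_)
open import Data.Product using (∃; _×_; _,_)
open import Data.Product.Properties using () 
open import Data.Sum using (_⊎_)
open import Function using (_∘_)
open import Relation.Nullary using (¬_; Dec; does)
open import Relation.Nullary.Decidable using (_⊎-dec_; _×-dec_; ¬?; _→-dec_)
open import Relation.Unary using (Pred; Decidable)
open import Relation.Binary.PropositionalEquality using (_≡_)
import Data.Nat as ℕ
import Agda.Primitive

countSubsets : ∀ {n} {P : Pred (Subset n) Agda.Primitive.lzero} → Decidable P → ℕ
countSubsets {zero}  P? = if does (P? []) then 1 else 0
countSubsets {suc n} P? = countSubsets (P? ∘ (inside ∷_)) + countSubsets (P? ∘ (outside ∷_))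

record Graph (m : ℕ) : Set₁ where
  field
    Adj  : Fin m → Fin m → Set
    adj? : ∀ u v → Dec (Adj u v)

open Graph public

PathAdj : ∀ {m} → Fin m → Fin m → Set
PathAdj u v = (suc (toℕ u) ≡ toℕ v) ⊎ (suc (toℕ v) ≡ toℕ u)

Path : (m : ℕ) → Graph m
Path m = record
  { Adj  = PathAdj
  ; adj? = λ u v → (suc (toℕ u) ℕ.≟ toℕ v) ⊎-dec (suc (toℕ v) ℕ.≟ toℕ u) }

module _ {m : ℕ} (G : Graph m) where

  IsDominating : Subset m → Set
  IsDominating D = ∀ v → v ∈ D ⊎ ∃ λ u → u ∈ D × Adj G u v

  isDominating? : Decidable IsDominating
  isDominating? D = all? λ v → (v ∈? D) ⊎-dec any? λ u → (u ∈? D) ×-dec adj? G u v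

  IsAccurate : Subset m → Set
  IsAccurate D = IsDominating D ×
    ¬ (∃ λ (S : Subset m) → (∀ x → x ∈ S → x ∈ ∁ D) × ∣ S ∣ ≡ ∣ D ∣ × IsDominating S)

  isAccurate? : Decidable IsAccurate
  isAccurate? D = isDominating? D ×-dec ¬? (anySubset? λ S →
    (all? λ x → (x ∈? S) →-dec (x ∈? ∁ D)) ×-dec ((∣ S ∣ ℕ.≟ ∣ D ∣) ×-dec isDominating? S))

  d : ℕ → ℕ
  d j = countSubsets λ D → isDominating? D ×-dec (∣ D ∣ ℕ.≟ j)

  dₐ : ℕ → ℕ
  dₐ j = countSubsets λ D → isAccurate? D ×-dec (∣ D ∣ ℕ.≟ j)

dPath : ℤ → ℤ → ℕ
dPath (+ m) (+ j) = d (Path m) j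
dPath (+ m) -[1+ _ ] = 0
dPath -[1+ _ ] _ = 0

-- Write n = m + 3 and i = j + 2, and read subsets of a path as bit strings. Putting 110 in
-- front of, or 011 behind, a dominating j-set E of P_m gives a dominating i-set of P_n that
-- contains an end vertex together with its only neighbour; no set disjoint from it dominates
-- that end vertex, so it is accurate. Each family has d(P_m, j) members, and a set in both is
-- 110·F·011 with |F| = j - 2 and F dominating P_(m-3), since vertices 0 and 1 dominate nothing
-- beyond vertex 2. Inclusion–exclusion gives the bound; paths with fewer than six vertices are
-- settled by evaluation.
module Submission where

open import Defs
open import Data.Nat using (ℕ; _≤_)
open import Data.Integer using (ℤ; +_; _-_; _*_) renaming (_≤_ to _≤ℤ_)

open import Data.Integer using (_⊖_)
open import Agda.Primitive using (lzero)
open import Data.Nat using (zero; suc; _+_; _∸_; _≟_; z≤n)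
import Data.Nat as ℕ
open import Data.Nat.Properties as ℕₚ
  using (≤-refl; ≤-reflexive; ≤-trans; +-mono-≤; m≤m+n; m≤n+m; +-identityʳ; suc-injective; module ≤-Reasoning)
open import Algebra.Properties.CommutativeSemigroup ℕₚ.+-commutativeSemigroup using (interchange)
import Data.Integer.Properties as ℤₚ
open import Data.Bool using (Bool)
open import Data.Bool.Properties using () renaming (_≟_ to _≟ᵇ_)
open import Data.Fin using (Fin; inject₁; fromℕ) renaming (zero to fz; suc to fs)
open import Data.Fin.Properties using (toℕ-inject₁; toℕ-fromℕ; toℕ-injective; toℕ<n)
open import Data.Fin.Subset using (Subset; inside; outside; _∈_; ∁; ∣_∣)
open import Data.Fin.Subset.Properties using (x∈∁p⇒x∉p)
open import Data.Vec using (Vec; []; _∷_; _∷ʳ_; here; there; head; tail; init; last; initLast)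
open import Data.Vec.Properties using (init-∷ʳ; last-∷ʳ; ∷ʳ-injectiveˡ)
open import Data.Product using (∃; _×_; _,_; proj₁; proj₂)
open import Data.Sum using (_⊎_; inj₁; inj₂)
import Data.Sum as Sum
open import Function using (_∘_; case_of_)
open import Relation.Nullary using (¬_; yes; no; contradiction)
open import Relation.Nullary.Decidable using (_×-dec_)
open import Relation.Unary using (Pred; Decidable; _⊆_; Empty)
open import Relation.Unary.Properties using (_∪?_; _∩?_)
open import Relation.Binary.PropositionalEquality
  using (_≡_; refl; sym; trans; cong; cong₂; subst; subst₂; module ≡-Reasoning)

countSubsets-mono : ∀ {n} {P Q : Pred (Subset n) lzero} (P? : Decidable P) (Q? : Decidable Q) →
  P ⊆ Q → countSubsets P? ≤ countSubsets Q?
countSubsets-mono {zero} P? Q? P⊆Q with P? [] | Q? []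
... | yes p | yes _ = ≤-refl
... | yes p | no ¬q = contradiction (P⊆Q p) ¬q
... | no _  | _     = z≤n
countSubsets-mono {suc n} P? Q? P⊆Q =
  +-mono-≤ (countSubsets-mono (P? ∘ (inside ∷_)) (Q? ∘ (inside ∷_)) P⊆Q)
           (countSubsets-mono (P? ∘ (outside ∷_)) (Q? ∘ (outside ∷_)) P⊆Q)

countSubsets-empty : ∀ {n} {P : Pred (Subset n) lzero} (P? : Decidable P) → Empty P → countSubsets P? ≡ 0
countSubsets-empty {zero} P? P-empty with P? []
... | yes p = contradiction p (P-empty [])
... | no _  = refl
countSubsets-empty {suc n} P? P-empty =
  cong₂ _+_ (countSubsets-empty (P? ∘ (inside ∷_)) (P-empty ∘ (inside ∷_)))
            (countSubsets-empty (P? ∘ (outside ∷_)) (P-empty ∘ (outside ∷_)))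

countSubsets-∪-∩ : ∀ {n} {P Q : Pred (Subset n) lzero} (P? : Decidable P) (Q? : Decidable Q) →
  countSubsets P? + countSubsets Q? ≡ countSubsets (P? ∪? Q?) + countSubsets (P? ∩? Q?)
countSubsets-∪-∩ {zero} P? Q? with P? [] | Q? []
... | yes _ | yes _ = refl
... | yes _ | no _  = refl
... | no _  | yes _ = refl
... | no _  | no _  = refl
countSubsets-∪-∩ {suc n} P? Q? = begin
  (p₁ + p₀) + (q₁ + q₀) ≡⟨ interchange p₁ p₀ q₁ q₀ ⟩
  (p₁ + q₁) + (p₀ + q₀) ≡⟨ cong₂ _+_ (countSubsets-∪-∩ (P? ∘ (inside ∷_)) (Q? ∘ (inside ∷_)))
                                      (countSubsets-∪-∩ (P? ∘ (outside ∷_)) (Q? ∘ (outside ∷_))) ⟩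
  (u₁ + i₁) + (u₀ + i₀) ≡⟨ interchange u₁ i₁ u₀ i₀ ⟩
  (u₁ + u₀) + (i₁ + i₀) ∎
  where
  open ≡-Reasoning
  p₁ = countSubsets (P? ∘ (inside ∷_))
  p₀ = countSubsets (P? ∘ (outside ∷_))
  q₁ = countSubsets (Q? ∘ (inside ∷_))
  q₀ = countSubsets (Q? ∘ (outside ∷_))
  u₁ = countSubsets ((P? ∪? Q?) ∘ (inside ∷_))
  u₀ = countSubsets ((P? ∪? Q?) ∘ (outside ∷_))
  i₁ = countSubsets ((P? ∩? Q?) ∘ (inside ∷_))
  i₀ = countSubsets ((P? ∩? Q?) ∘ (outside ∷_))

countSubsets-∷ʳ : ∀ {n} {P : Pred (Subset (suc n)) lzero} (P? : Decidable P) →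
  countSubsets P? ≡ countSubsets (P? ∘ (_∷ʳ inside)) + countSubsets (P? ∘ (_∷ʳ outside))
countSubsets-∷ʳ {zero} P? = refl
countSubsets-∷ʳ {suc n} P?
  rewrite countSubsets-∷ʳ (P? ∘ (inside ∷_)) | countSubsets-∷ʳ (P? ∘ (outside ∷_)) =
  interchange (countSubsets (λ E → P? (inside ∷ (E ∷ʳ inside))))
              (countSubsets (λ E → P? (inside ∷ (E ∷ʳ outside))))
              (countSubsets (λ E → P? (outside ∷ (E ∷ʳ inside))))
              (countSubsets (λ E → P? (outside ∷ (E ∷ʳ outside))))

countSubsets-∷-≤ : ∀ {n} {P : Pred (Subset (suc n)) lzero} (P? : Decidable P) x →
  countSubsets (P? ∘ (x ∷_)) ≤ countSubsets P?
countSubsets-∷-≤ P? inside  = m≤m+n _ _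
countSubsets-∷-≤ P? outside = m≤n+m _ _

countSubsets-∷ʳ-≤ : ∀ {n} {P : Pred (Subset (suc n)) lzero} (P? : Decidable P) x →
  countSubsets (P? ∘ (_∷ʳ x)) ≤ countSubsets P?
countSubsets-∷ʳ-≤ P? inside  = ≤-trans (m≤m+n _ _) (≤-reflexive (sym (countSubsets-∷ʳ P?)))
countSubsets-∷ʳ-≤ P? outside = ≤-trans (m≤n+m _ _) (≤-reflexive (sym (countSubsets-∷ʳ P?)))

countSubsets-head-forced : ∀ {n} {P : Pred (Subset (suc n)) lzero} (P? : Decidable P) x →
  (∀ {D} → P D → head D ≡ x) → countSubsets P? ≤ countSubsets (P? ∘ (x ∷_))
countSubsets-head-forced P? inside forced = ≤-reflexive (begin
  countSubsets (P? ∘ (inside ∷_)) + countSubsets (P? ∘ (outside ∷_))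
    ≡⟨ cong₂ _+_ refl (countSubsets-empty (P? ∘ (outside ∷_)) λ D p → contradiction (forced {outside ∷ D} p) λ ()) ⟩
  countSubsets (P? ∘ (inside ∷_)) + 0
    ≡⟨ +-identityʳ _ ⟩
  countSubsets (P? ∘ (inside ∷_)) ∎)
  where open ≡-Reasoning
countSubsets-head-forced P? outside forced = ≤-reflexive
  (cong₂ _+_ (countSubsets-empty (P? ∘ (inside ∷_)) λ D p → contradiction (forced {inside ∷ D} p) λ ()) refl)

countSubsets-last-forced : ∀ {n} {P : Pred (Subset (suc n)) lzero} (P? : Decidable P) x →
  (∀ {D} → P D → last D ≡ x) → countSubsets P? ≤ countSubsets (P? ∘ (_∷ʳ x))
countSubsets-last-forced P? inside forced = ≤-reflexive (begin
  countSubsets P?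
    ≡⟨ countSubsets-∷ʳ P? ⟩
  countSubsets (P? ∘ (_∷ʳ inside)) + countSubsets (P? ∘ (_∷ʳ outside))
    ≡⟨ cong₂ _+_ refl (countSubsets-empty (P? ∘ (_∷ʳ outside)) λ E p →
         contradiction (trans (sym (last-∷ʳ outside E)) (forced p)) λ ()) ⟩
  countSubsets (P? ∘ (_∷ʳ inside)) + 0
    ≡⟨ +-identityʳ _ ⟩
  countSubsets (P? ∘ (_∷ʳ inside)) ∎)
  where open ≡-Reasoning
countSubsets-last-forced P? outside forced = ≤-reflexive (begin
  countSubsets P?
    ≡⟨ countSubsets-∷ʳ P? ⟩
  countSubsets (P? ∘ (_∷ʳ inside)) + countSubsets (P? ∘ (_∷ʳ outside))
    ≡⟨ cong₂ _+_ (countSubsets-empty (P? ∘ (_∷ʳ inside)) λ E p →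
         contradiction (trans (sym (last-∷ʳ inside E)) (forced p)) λ ()) refl ⟩
  countSubsets (P? ∘ (_∷ʳ outside)) ∎)
  where open ≡-Reasoning

infixr 6 _◁_ _◁?_
infixl 6 _▷_ _▷?_

_◁_ : ∀ {n} → Bool → Pred (Subset n) lzero → Pred (Subset (suc n)) lzero
(x ◁ P) D = head D ≡ x × P (tail D)

_◁?_ : ∀ {n} {P : Pred (Subset n) lzero} x → Decidable P → Decidable (x ◁ P)
(x ◁? P?) D = (head D ≟ᵇ x) ×-dec P? (tail D)

_▷_ : ∀ {n} → Pred (Subset n) lzero → Bool → Pred (Subset (suc n)) lzero
(P ▷ x) D = P (init D) × last D ≡ x

_▷?_ : ∀ {n} {P : Pred (Subset n) lzero} → Decidable P → ∀ x → Decidable (P ▷ x)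
(P? ▷? x) D = P? (init D) ×-dec (last D ≟ᵇ x)

▷-∷ʳ⁺ : ∀ {n} (P : Pred (Subset n) lzero) E x → P E → (P ▷ x) (E ∷ʳ x)
▷-∷ʳ⁺ P E x p = subst P (sym (init-∷ʳ x E)) p , last-∷ʳ x E

▷-view : ∀ {n} (P : Pred (Subset n) lzero) {x} D → (P ▷ x) D → ∃ λ E → P E × D ≡ E ∷ʳ x
▷-view P D (p , refl) = init D , p , proj₂ (proj₂ (initLast D))

Dominating : ∀ m → Pred (Subset m) lzero
Dominating m = IsDominating (Path m)

DominatedBy : ∀ {m} → Subset m → Fin m → Set
DominatedBy D v = v ∈ D ⊎ ∃ λ u → u ∈ D × PathAdj u v

PathAdj-sym : ∀ {m} {u v : Fin m} → PathAdj u v → PathAdj v u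
PathAdj-sym = Sum.swap

PathAdj-suc : ∀ {m} {u v : Fin m} → PathAdj u v → PathAdj (fs u) (fs v)
PathAdj-suc = Sum.map (cong suc) (cong suc)

PathAdj-suc⁻ : ∀ {m} {u v : Fin m} → PathAdj (fs u) (fs v) → PathAdj u v
PathAdj-suc⁻ = Sum.map suc-injective suc-injective

PathAdj-inject₁ : ∀ {m} {u v : Fin m} → PathAdj u v → PathAdj (inject₁ u) (inject₁ v)
PathAdj-inject₁ {u = u} {v} rewrite toℕ-inject₁ u | toℕ-inject₁ v = λ u~v → u~v

PathAdj-fromℕ : ∀ n → PathAdj (inject₁ (fromℕ n)) (fromℕ (suc n))
PathAdj-fromℕ n = inj₁ (cong suc (toℕ-inject₁ (fromℕ n)))

PathAdj-fromℕ⁻ : ∀ {n} {u : Fin (2 + n)} → PathAdj u (fromℕ (suc n)) → u ≡ inject₁ (fromℕ n)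
PathAdj-fromℕ⁻ {n} (inj₁ e) = toℕ-injective (trans (suc-injective e) (sym (toℕ-inject₁ (fromℕ n))))
PathAdj-fromℕ⁻ {n} {u} (inj₂ e) =
  contradiction (trans (sym e) (cong (suc ∘ suc) (toℕ-fromℕ n))) (ℕₚ.<⇒≢ (toℕ<n u))

dominatedBy-∷ : ∀ {m x} {D : Subset m} {v} → DominatedBy D v → DominatedBy (x ∷ D) (fs v)
dominatedBy-∷ (inj₁ v∈D)             = inj₁ (there v∈D)
dominatedBy-∷ (inj₂ (u , u∈D , u~v)) = inj₂ (fs u , there u∈D , PathAdj-suc u~v)

∈-∷ʳ⁺ : ∀ {m x} {D : Subset m} {v} → v ∈ D → inject₁ v ∈ D ∷ʳ x
∈-∷ʳ⁺ here      = here
∈-∷ʳ⁺ (there p) = there (∈-∷ʳ⁺ p)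

fromℕ-∈-∷ʳ : ∀ {m} (D : Subset m) → fromℕ m ∈ D ∷ʳ inside
fromℕ-∈-∷ʳ []      = here
fromℕ-∈-∷ʳ (_ ∷ D) = there (fromℕ-∈-∷ʳ D)

dominatedBy-∷ʳ : ∀ {m x} {D : Subset m} {v} → DominatedBy D v → DominatedBy (D ∷ʳ x) (inject₁ v)
dominatedBy-∷ʳ (inj₁ v∈D)             = inj₁ (∈-∷ʳ⁺ v∈D)
dominatedBy-∷ʳ (inj₂ (u , u∈D , u~v)) = inj₂ (inject₁ u , ∈-∷ʳ⁺ u∈D , PathAdj-inject₁ u~v)

data InjectOrGreatest {n} : Fin (suc n) → Set where
  inject   : ∀ v → InjectOrGreatest (inject₁ v)
  greatest : InjectOrGreatest (fromℕ n)

injectOrGreatest : ∀ {n} (v : Fin (suc n)) → InjectOrGreatest v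
injectOrGreatest {zero}  fz     = greatest
injectOrGreatest {suc n} fz     = inject fz
injectOrGreatest {suc n} (fs v) with injectOrGreatest v
... | inject w = inject (fs w)
... | greatest = greatest

dominating-extendˡ : ∀ {m} x {F : Subset m} → Dominating m F → Dominating (3 + m) (x ∷ inside ∷ outside ∷ F)
dominating-extendˡ x F-dom fz               = inj₂ (fs fz , there here , inj₂ refl)
dominating-extendˡ x F-dom (fs fz)          = inj₁ (there here)
dominating-extendˡ x F-dom (fs (fs fz))     = inj₂ (fs fz , there here , inj₁ refl)
dominating-extendˡ x F-dom (fs (fs (fs v))) = dominatedBy-∷ (dominatedBy-∷ (dominatedBy-∷ (F-dom v)))

dominating-shrinkˡ : ∀ {m} x y {F : Subset m} → Dominating (3 + m) (x ∷ y ∷ outside ∷ F) → Dominating m F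
dominating-shrinkˡ x y dom v with dom (fs (fs (fs v)))
... | inj₁ (there (there (there v∈F))) = inj₁ v∈F
... | inj₂ (fs (fs (fs u)) , there (there (there u∈F)) , u~v) =
  inj₂ (u , u∈F , PathAdj-suc⁻ (PathAdj-suc⁻ (PathAdj-suc⁻ u~v)))
... | inj₂ (fs (fs fz) , there (there ()) , _)
... | inj₂ (fz , _ , inj₁ ())
... | inj₂ (fz , _ , inj₂ ())
... | inj₂ (fs fz , _ , inj₁ ())
... | inj₂ (fs fz , _ , inj₂ ())

dominating-extendʳ : ∀ {m} x {E : Subset m} → Dominating m E → Dominating (3 + m) (E ∷ʳ outside ∷ʳ inside ∷ʳ x)
dominating-extendʳ {m} x {E} E-dom v with injectOrGreatest v
... | greatest = inj₂ (_ , ∈-∷ʳ⁺ (fromℕ-∈-∷ʳ (E ∷ʳ outside)) , PathAdj-fromℕ (suc m))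
... | inject v′ with injectOrGreatest v′
...   | greatest = inj₁ (∈-∷ʳ⁺ (fromℕ-∈-∷ʳ (E ∷ʳ outside)))
...   | inject v″ with injectOrGreatest v″
...     | greatest = inj₂ (_ , ∈-∷ʳ⁺ (fromℕ-∈-∷ʳ (E ∷ʳ outside)) , PathAdj-inject₁ (PathAdj-sym (PathAdj-fromℕ m)))
...     | inject w = dominatedBy-∷ʳ (dominatedBy-∷ʳ (dominatedBy-∷ʳ (E-dom w)))

accurate-if-closedNeighbourhood⊆ : ∀ {m} (G : Graph m) {D : Subset m} v → v ∈ D → (∀ {u} → Adj G u v → u ∈ D) →
  IsDominating G D → IsAccurate G D
accurate-if-closedNeighbourhood⊆ G {D} v v∈D N⊆D D-dom = D-dom , λ (S , S⊆∁D , _ , S-dom) → avoids S⊆∁D (S-dom v)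
  where
  avoids : ∀ {S} → (∀ x → x ∈ S → x ∈ ∁ D) → ¬ (v ∈ S ⊎ ∃ λ u → u ∈ S × Adj G u v)
  avoids S⊆∁D (inj₁ v∈S)             = x∈∁p⇒x∉p (S⊆∁D v v∈S) v∈D
  avoids S⊆∁D (inj₂ (u , u∈S , u~v)) = x∈∁p⇒x∉p (S⊆∁D u u∈S) (N⊆D u~v)

accurate-if-first-two : ∀ {m} {D : Subset m} → Dominating (2 + m) (inside ∷ inside ∷ D) →
  IsAccurate (Path (2 + m)) (inside ∷ inside ∷ D)
accurate-if-first-two = accurate-if-closedNeighbourhood⊆ (Path _) fz here neighbour∈
  where
  neighbour∈ : ∀ {m} {D : Subset m} {u} → PathAdj u fz → u ∈ inside ∷ inside ∷ D
  neighbour∈ {u = fs fz}     _        = there here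
  neighbour∈ {u = fz}        (inj₁ ())
  neighbour∈ {u = fz}        (inj₂ ())
  neighbour∈ {u = fs (fs _)} (inj₁ ())
  neighbour∈ {u = fs (fs _)} (inj₂ ())

accurate-if-last-two : ∀ {m} {D : Subset m} → Dominating (2 + m) (D ∷ʳ inside ∷ʳ inside) →
  IsAccurate (Path (2 + m)) (D ∷ʳ inside ∷ʳ inside)
accurate-if-last-two {m} {D} = accurate-if-closedNeighbourhood⊆ (Path _) (fromℕ (suc m)) (fromℕ-∈-∷ʳ _) neighbour∈
  where
  neighbour∈ : ∀ {u} → PathAdj u (fromℕ (suc m)) → u ∈ D ∷ʳ inside ∷ʳ inside
  neighbour∈ u~last rewrite PathAdj-fromℕ⁻ u~last = ∈-∷ʳ⁺ (fromℕ-∈-∷ʳ D)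

∣∷ʳ∣ : ∀ {n} (D : Subset n) x → ∣ D ∷ʳ x ∣ ≡ ∣ x ∷ D ∣
∣∷ʳ∣ []            x       = refl
∣∷ʳ∣ (inside ∷ D)  inside  = cong suc (∣∷ʳ∣ D inside)
∣∷ʳ∣ (inside ∷ D)  outside = cong suc (∣∷ʳ∣ D outside)
∣∷ʳ∣ (outside ∷ D) inside  = ∣∷ʳ∣ D inside
∣∷ʳ∣ (outside ∷ D) outside = ∣∷ʳ∣ D outside

∣∷ʳ011∣ : ∀ {n} (D : Subset n) → ∣ D ∷ʳ outside ∷ʳ inside ∷ʳ inside ∣ ≡ 2 + ∣ D ∣
∣∷ʳ011∣ D = begin
  ∣ D ∷ʳ outside ∷ʳ inside ∷ʳ inside ∣ ≡⟨ ∣∷ʳ∣ (D ∷ʳ outside ∷ʳ inside) inside ⟩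
  suc ∣ D ∷ʳ outside ∷ʳ inside ∣       ≡⟨ cong suc (∣∷ʳ∣ (D ∷ʳ outside) inside) ⟩
  2 + ∣ D ∷ʳ outside ∣                 ≡⟨ cong (suc ∘ suc) (∣∷ʳ∣ D outside) ⟩
  2 + ∣ D ∣                            ∎
  where open ≡-Reasoning

dominatingOfSize? : ∀ m j → Decidable (λ (D : Subset m) → Dominating m D × ∣ D ∣ ≡ j)
dominatingOfSize? m j D = isDominating? (Path m) D ×-dec (∣ D ∣ ≟ j)

module Capped (m j : ℕ) where

  PrefixCapped SuffixCapped : Pred (Subset (3 + m)) lzero
  PrefixCapped D = (inside ◁ inside ◁ outside ◁ Dominating m) D × ∣ D ∣ ≡ 2 + j
  SuffixCapped D = (Dominating m ▷ outside ▷ inside ▷ inside) D × ∣ D ∣ ≡ 2 + j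

  prefixCapped? : Decidable PrefixCapped
  prefixCapped? D = (inside ◁? inside ◁? outside ◁? isDominating? (Path m)) D ×-dec (∣ D ∣ ≟ 2 + j)

  suffixCapped? : Decidable SuffixCapped
  suffixCapped? D = (isDominating? (Path m) ▷? outside ▷? inside ▷? inside) D ×-dec (∣ D ∣ ≟ 2 + j)

  suffixCapped-∷ʳ⁺ : ∀ E → Dominating m E → (Dominating m ▷ outside ▷ inside ▷ inside) (E ∷ʳ outside ∷ʳ inside ∷ʳ inside)
  suffixCapped-∷ʳ⁺ E =
    ▷-∷ʳ⁺ (Dominating m ▷ outside ▷ inside) (E ∷ʳ outside ∷ʳ inside) inside ∘
    ▷-∷ʳ⁺ (Dominating m ▷ outside) (E ∷ʳ outside) inside ∘
    ▷-∷ʳ⁺ (Dominating m) E outside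

  suffixCapped-view : ∀ D → (Dominating m ▷ outside ▷ inside ▷ inside) D →
    ∃ λ E → Dominating m E × D ≡ E ∷ʳ outside ∷ʳ inside ∷ʳ inside
  suffixCapped-view D capped with ▷-view (Dominating m ▷ outside ▷ inside) D capped
  ... | D′ , capped′ , refl with ▷-view (Dominating m ▷ outside) D′ capped′
  ... | D″ , capped″ , refl with ▷-view (Dominating m) D″ capped″
  ... | E , E-dom , refl = E , E-dom , refl

  BothCapped : Pred (Subset (3 + m)) lzero
  BothCapped D = PrefixCapped D × SuffixCapped D

  bothCapped? : Decidable BothCapped
  bothCapped? = prefixCapped? ∩? suffixCapped?

  d≤#prefixCapped : d (Path m) j ≤ countSubsets prefixCapped?
  d≤#prefixCapped = begin
    countSubsets (dominatingOfSize? m j)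
      ≤⟨ countSubsets-mono (dominatingOfSize? m j) (prefixCapped? ∘ (inside ∷_) ∘ (inside ∷_) ∘ (outside ∷_))
           (λ (E-dom , ∣E∣≡j) → (refl , refl , refl , E-dom) , cong (suc ∘ suc) ∣E∣≡j) ⟩
    countSubsets (prefixCapped? ∘ (inside ∷_) ∘ (inside ∷_) ∘ (outside ∷_))
      ≤⟨ countSubsets-∷-≤ (prefixCapped? ∘ (inside ∷_) ∘ (inside ∷_)) outside ⟩
    countSubsets (prefixCapped? ∘ (inside ∷_) ∘ (inside ∷_))
      ≤⟨ countSubsets-∷-≤ (prefixCapped? ∘ (inside ∷_)) inside ⟩
    countSubsets (prefixCapped? ∘ (inside ∷_))
      ≤⟨ countSubsets-∷-≤ prefixCapped? inside ⟩
    countSubsets prefixCapped? ∎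
    where open ≤-Reasoning

  d≤#suffixCapped : d (Path m) j ≤ countSubsets suffixCapped?
  d≤#suffixCapped = begin
    countSubsets (dominatingOfSize? m j)
      ≤⟨ countSubsets-mono (dominatingOfSize? m j) (suffixCapped? ∘ (_∷ʳ inside) ∘ (_∷ʳ inside) ∘ (_∷ʳ outside))
           (λ {E} (E-dom , ∣E∣≡j) → suffixCapped-∷ʳ⁺ E E-dom , trans (∣∷ʳ011∣ E) (cong (suc ∘ suc) ∣E∣≡j)) ⟩
    countSubsets (suffixCapped? ∘ (_∷ʳ inside) ∘ (_∷ʳ inside) ∘ (_∷ʳ outside))
      ≤⟨ countSubsets-∷ʳ-≤ (suffixCapped? ∘ (_∷ʳ inside) ∘ (_∷ʳ inside)) outside ⟩
    countSubsets (suffixCapped? ∘ (_∷ʳ inside) ∘ (_∷ʳ inside))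
      ≤⟨ countSubsets-∷ʳ-≤ (suffixCapped? ∘ (_∷ʳ inside)) inside ⟩
    countSubsets (suffixCapped? ∘ (_∷ʳ inside))
      ≤⟨ countSubsets-∷ʳ-≤ suffixCapped? inside ⟩
    countSubsets suffixCapped? ∎
    where open ≤-Reasoning

  prefixCapped⇒accurate : ∀ {D} → PrefixCapped D → IsAccurate (Path (3 + m)) D
  prefixCapped⇒accurate {_ ∷ _ ∷ _ ∷ _} ((refl , refl , refl , E-dom) , _) =
    accurate-if-first-two (dominating-extendˡ inside E-dom)

  suffixCapped⇒accurate : ∀ {D} → SuffixCapped D → IsAccurate (Path (3 + m)) D
  suffixCapped⇒accurate {D} (capped , _) with suffixCapped-view D capped
  ... | E , E-dom , refl = accurate-if-last-two (dominating-extendʳ inside E-dom)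

  #prefixCapped∪suffixCapped≤dₐ : countSubsets (prefixCapped? ∪? suffixCapped?) ≤ dₐ (Path (3 + m)) (2 + j)
  #prefixCapped∪suffixCapped≤dₐ =
    countSubsets-mono (prefixCapped? ∪? suffixCapped?) (λ D → isAccurate? (Path (3 + m)) D ×-dec (∣ D ∣ ≟ 2 + j)) λ where
    (inj₁ D∈P@(_ , ∣D∣≡2+j)) → prefixCapped⇒accurate D∈P , ∣D∣≡2+j
    (inj₂ D∈S@(_ , ∣D∣≡2+j)) → suffixCapped⇒accurate D∈S , ∣D∣≡2+j

∷ʳ⇒last : ∀ {A : Set} {n} {xs : Vec A (suc n)} {ys y} → xs ≡ ys ∷ʳ y → last xs ≡ y
∷ʳ⇒last {ys = ys} {y} refl = last-∷ʳ y ys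

module Overlap (k j : ℕ) where
  open Capped (3 + k) j

  doublyCapped : Subset k → Subset (6 + k)
  doublyCapped F = inside ∷ inside ∷ outside ∷ (F ∷ʳ outside ∷ʳ inside ∷ʳ inside)

  private
    overlap-view : ∀ D → BothCapped D → ∃ λ E → Dominating (3 + k) E × D ≡ E ∷ʳ outside ∷ʳ inside ∷ʳ inside
    overlap-view D (_ , capped , _) = suffixCapped-view D capped

    suffix-eq : ∀ D (p : BothCapped D) → D ≡ proj₁ (overlap-view D p) ∷ʳ outside ∷ʳ inside ∷ʳ inside
    suffix-eq D p = proj₂ (proj₂ (overlap-view D p))

  #bothCapped≤#doublyCapped : countSubsets bothCapped? ≤ countSubsets (bothCapped? ∘ doublyCapped)
  #bothCapped≤#doublyCapped = begin
    countSubsets bothCapped?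
      ≤⟨ countSubsets-head-forced bothCapped? inside (λ (((h , _) , _) , _) → h) ⟩
    countSubsets (bothCapped? ∘ (inside ∷_))
      ≤⟨ countSubsets-head-forced (bothCapped? ∘ (inside ∷_)) inside (λ (((_ , h , _) , _) , _) → h) ⟩
    countSubsets (bothCapped? ∘ (inside ∷_) ∘ (inside ∷_))
      ≤⟨ countSubsets-head-forced (bothCapped? ∘ (inside ∷_) ∘ (inside ∷_)) outside (λ (((_ , _ , h , _) , _) , _) → h) ⟩
    countSubsets (bothCapped? ∘ prefix)
      ≤⟨ countSubsets-last-forced (bothCapped? ∘ prefix) inside (λ {D} p → ∷ʳ⇒last (suffix-eq (prefix D) p)) ⟩
    countSubsets (bothCapped? ∘ prefix ∘ (_∷ʳ inside))
      ≤⟨ countSubsets-last-forced (bothCapped? ∘ prefix ∘ (_∷ʳ inside)) inside (λ {D} p →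
           ∷ʳ⇒last (∷ʳ-injectiveˡ (prefix D) _ (suffix-eq (prefix (D ∷ʳ inside)) p))) ⟩
    countSubsets (bothCapped? ∘ prefix ∘ (_∷ʳ inside) ∘ (_∷ʳ inside))
      ≤⟨ countSubsets-last-forced (bothCapped? ∘ prefix ∘ (_∷ʳ inside) ∘ (_∷ʳ inside)) outside (λ {D} p →
           ∷ʳ⇒last (∷ʳ-injectiveˡ (prefix D) _
                     (∷ʳ-injectiveˡ (prefix D ∷ʳ inside) _ (suffix-eq (prefix (D ∷ʳ inside ∷ʳ inside)) p)))) ⟩
    countSubsets (bothCapped? ∘ doublyCapped) ∎
    where
    open ≤-Reasoning
    prefix : ∀ {n} → Subset n → Subset (3 + n)
    prefix D = inside ∷ inside ∷ outside ∷ D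

  doublyCapped-dominating : ∀ {F} → BothCapped (doublyCapped F) → Dominating k F × 4 + ∣ F ∣ ≡ 2 + j
  doublyCapped-dominating {F} p@(_ , _ , ∣D∣≡2+j) with overlap-view (doublyCapped F) p
  ... | E , E-dom , eq = dominating-shrinkˡ inside inside (subst (Dominating (3 + k)) (sym F-eq) E-dom) ,
                         trans (sym (cong (suc ∘ suc) (∣∷ʳ011∣ F))) ∣D∣≡2+j
    where
    F-eq : inside ∷ inside ∷ outside ∷ F ≡ E
    F-eq = ∷ʳ-injectiveˡ _ _ (∷ʳ-injectiveˡ _ _
             (∷ʳ-injectiveˡ (inside ∷ inside ∷ outside ∷ (F ∷ʳ outside ∷ʳ inside)) _ eq))

#doublyCapped≤dPath : ∀ k j →
  countSubsets (Capped.bothCapped? (3 + k) j ∘ Overlap.doublyCapped k j) ≤ dPath (+ k) (+ (2 + j) - + 4)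
#doublyCapped≤dPath k 0 = ≤-reflexive (countSubsets-empty (bothCapped? ∘ doublyCapped) λ F p →
  case proj₂ (doublyCapped-dominating {F} p) of λ ())
  where open Capped (3 + k) 0; open Overlap k 0
#doublyCapped≤dPath k 1 = ≤-reflexive (countSubsets-empty (bothCapped? ∘ doublyCapped) λ F p →
  case proj₂ (doublyCapped-dominating {F} p) of λ ())
  where open Capped (3 + k) 1; open Overlap k 1
#doublyCapped≤dPath k (suc (suc j)) = countSubsets-mono (bothCapped? ∘ doublyCapped) (dominatingOfSize? k j) λ {F} p →
  let F-dom , size = doublyCapped-dominating {F} p in F-dom , ℕₚ.+-cancelˡ-≡ 4 _ _ size
  where open Capped (3 + k) (2 + j); open Overlap k (2 + j)

d+d≤dₐ+d : ∀ k j →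
  d (Path (3 + k)) j + d (Path (3 + k)) j ≤ dₐ (Path (3 + (3 + k))) (2 + j) + dPath (+ k) (+ (2 + j) - + 4)
d+d≤dₐ+d k j = begin
  d (Path (3 + k)) j + d (Path (3 + k)) j
    ≤⟨ +-mono-≤ d≤#prefixCapped d≤#suffixCapped ⟩
  countSubsets prefixCapped? + countSubsets suffixCapped?
    ≡⟨ countSubsets-∪-∩ prefixCapped? suffixCapped? ⟩
  countSubsets (prefixCapped? ∪? suffixCapped?) + countSubsets bothCapped?
    ≤⟨ +-mono-≤ #prefixCapped∪suffixCapped≤dₐ (≤-trans #bothCapped≤#doublyCapped (#doublyCapped≤dPath k j)) ⟩
  dₐ (Path (3 + (3 + k))) (2 + j) + dPath (+ k) (+ (2 + j) - + 4) ∎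
  where
  open Capped (3 + k) j
  open Overlap k j
  open ≤-Reasoning

a+a≤c+b⇒2a-b≤c : ∀ a b c → a + a ≤ c + b → + 2 * + a - + b ≤ℤ + c
a+a≤c+b⇒2a-b≤c a b c a+a≤c+b = begin
  + 2 * + a - + b      ≡⟨ cong (_- + b) (sym (ℤₚ.pos-* 2 a)) ⟩
  + (2 ℕ.* a) - + b    ≡⟨ ℤₚ.[+m]-[+n]≡m⊖n (2 ℕ.* a) b ⟩
  (2 ℕ.* a) ⊖ b        ≤⟨ ℤₚ.⊖-monoˡ-≤ b 2a≤c+b ⟩
  (c + b) ⊖ b          ≡⟨ ℤₚ.≤-⊖ (m≤n+m b c) ⟩
  + (c + b ∸ b)        ≡⟨ cong (λ x → + x) (ℕₚ.m+n∸n≡m c b) ⟩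
  + c                  ∎
  where
  open ℤₚ.≤-Reasoning
  2a≤c+b : 2 ℕ.* a ≤ c + b
  2a≤c+b = subst (_≤ c + b) (cong (λ x → a + x) (sym (+-identityʳ a))) a+a≤c+b

AccurateBound : ℕ → ℕ → Set
AccurateBound n i = (+ 2) * (+ dPath (+ n - + 3) (+ i - + 2)) - (+ dPath (+ n - + 6) (+ i - + 4)) ≤ℤ + dₐ (Path n) i

accurateBound : ∀ k j → AccurateBound (3 + (3 + k)) (2 + j)
accurateBound k j =
  a+a≤c+b⇒2a-b≤c (d (Path (3 + k)) j) (dPath (+ k) (+ (2 + j) - + 4)) (dₐ (Path (3 + (3 + k))) (2 + j))
    (d+d≤dₐ+d k j)

theorem3p6 : (n i : ℕ) → 1 ≤ n → 1 ≤ i →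
    (+ 2) * (+ dPath (+ n - + 3) (+ i - + 2)) - (+ dPath (+ n - + 6) (+ i - + 4)) ≤ℤ + dₐ (Path n) i
theorem3p6 (suc (suc (suc (suc (suc (suc k)))))) (suc (suc j)) _ _ =
  -- Transported from 3 + (3 + k): comparing that index with the numeral directly makes Agda
  -- normalise dₐ.
  subst₂ AccurateBound {3 + (3 + k)} {suc (suc (suc (suc (suc (suc k)))))} {2 + j} {suc (suc j)} refl refl
    (accurateBound k j)
theorem3p6 (suc (suc (suc (suc (suc (suc k)))))) 1 _ _ = ℤₚ.≤ᵇ⇒≤ _
theorem3p6 0 _ () _
theorem3p6 _ 0 _ ()
theorem3p6 1 (suc i) _ _ = ℤₚ.≤ᵇ⇒≤ _
theorem3p6 2 (suc i) _ _ = ℤₚ.≤ᵇ⇒≤ _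
theorem3p6 3 1 _ _ = ℤₚ.≤ᵇ⇒≤ _
theorem3p6 3 2 _ _ = ℤₚ.≤ᵇ⇒≤ _
theorem3p6 3 (suc (suc (suc i))) _ _ = ℤₚ.≤ᵇ⇒≤ _
theorem3p6 4 1 _ _ = ℤₚ.≤ᵇ⇒≤ _
theorem3p6 4 2 _ _ = ℤₚ.≤ᵇ⇒≤ _
theorem3p6 4 3 _ _ = ℤₚ.≤ᵇ⇒≤ _
theorem3p6 4 (suc (suc (suc (suc i)))) _ _ = ℤₚ.≤ᵇ⇒≤ _
theorem3p6 5 1 _ _ = ℤₚ.≤ᵇ⇒≤ _
theorem3p6 5 2 _ _ = ℤₚ.≤ᵇ⇒≤ _
theorem3p6 5 3 _ _ = ℤₚ.≤ᵇ⇒≤ _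
theorem3p6 5 4 _ _ = ℤₚ.≤ᵇ⇒≤ _
theorem3p6 5 (suc (suc (suc (suc (suc i))))) _ _ = ℤₚ.≤ᵇ⇒≤ _
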